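{- There is an algorithm that, given a deducibility constraint system $C$ (in which some fixed name belongs to the left side of every constraint), decides whether $C$ is satisfiable.
   Context: Messages are built from countably infinite sets of names and variables using only pairing $\langle M,N\rangle$ and symmetric encryption $\{M\}_N$; equality is syntactic. $V(\cdot)$ is the set of variables occurring in an object; a message is ground if variable-free. Sequent rules ($\Gamma,M$ means $\Gamma\cup\{M\}$): (id) $\Gamma\vdash M$ if $M\in\Gamma$; ($p_L$) from $\Gamma,\langle M,N\rangle,M,N\vdash T$ infer $\Gamma,\langle M,N\rangle\vdash T$; ($p_R$) from $\Gamma\vdash M$, $\Gamma\vdash N$ infer $\Gamma\vdash\langle M,N\rangle$; ($e_L$) from $\Gamma,\{M\}_K\vdash K$ and $\Gamma,\{M\}_K,M,K\vdash N$ infer $\Gamma,\{M\}_K\vdash N$; ($e_R$) from $\Gamma\vdash M$, $\Gamma\vdash K$ infer $\Gamma\vdash\{M\}_K$. $\Gamma\Vdash M$: derivable; $\Gamma\Vdash_R M$: derivable using only id, $p_R$, $e_R$; $\Gamma\Vdash\Delta$: $\Gamma\Vdash N$ for all $N\in\Delta$. A deducibility constraint is $\Sigma\Vdash^? M$ (proper) or $\Sigma\Vdash^?_R M$ (right), with $\Sigma$ a finite set of messages. Substitutions are applied postfix; a ground substitution $\theta$ is a solution of a list $C$ of constraints if $\Sigma\theta\Vdash M\theta$ for each proper and $\Sigma\theta\Vdash_R M\theta$ for each right constraint of $C$; $C$ is satisfiable if it has a solution. $C^i$ is the prefix of $C$ of length $i-1$. A deducibility constraint system is a list $\Sigma_1\Vdash^?_{(R)}M_1;\cdots;\Sigma_n\Vdash^?_{(R)}M_n$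 (each proper or right) such that: (1) for all $i<j$, if $\Sigma_j^{dv}$ is $\Sigma_j$ with all messages deleted that contain a variable occurring in no message of $\Sigma_i$, then every solution $\theta$ of $C^j$ satisfies $\Sigma_j^{dv}\theta\Vdash\Sigma_i\theta$; (2) for every $x\in V(C)$ there is $i$ with $x\in V(M_i)$, $x\notin V(\Sigma_i)$, and $x$ occurring in no constraint with index $j<i$. -}

module Defs where

open import Data.Nat using (ℕ)
open import Data.Nat.Properties using (_≟_)
open import Data.Bool using (Bool)
open import Data.Fin using (Fin; toℕ) renaming (_<_ to _<ᶠ_)
open import Data.List using (List; []; _∷_; _++_; concatMap; map; length; lookup; take; filter)
open import Data.List.Membership.Propositional using (_∈_; _∉_)
open import Data.List.Membership.DecPropositional _≟_ using (_∈?_)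
open import Data.List.Relation.Unary.All using (All; all?)
open import Data.Product using (Σ; _×_; ∃)
open import Relation.Nullary using (¬_)

-- Messages: names and variables (both indexed by ℕ), pairing, symmetric encryption.
data Msg : Set where
  name : ℕ → Msg
  var  : ℕ → Msg
  ⟨_,_⟩ : Msg → Msg → Msg
  ⟦_⟧_ : Msg → Msg → Msg

vars : Msg → List ℕ
vars (name a) = []
vars (var x) = x ∷ []
vars ⟨ M , N ⟩ = vars M ++ vars N
vars (⟦ M ⟧ K) = vars M ++ vars K

varsL : List Msg → List ℕ
varsL = concatMap vars

Ground : Msg → Set
Ground M = ∀ x → x ∉ vars M

-- Sequent calculus.  Finite sets Γ are lists; "Γ, M" with M ∈ Γ is Γ itself,
-- and adding M to Γ is M ∷ Γ.
infix 4 _⊩_ _⊩R_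
data _⊩_ (Γ : List Msg) : Msg → Set where
  id : ∀ {M} → M ∈ Γ → Γ ⊩ M
  pL : ∀ {M N T} → ⟨ M , N ⟩ ∈ Γ → (M ∷ N ∷ Γ) ⊩ T → Γ ⊩ T
  pR : ∀ {M N} → Γ ⊩ M → Γ ⊩ N → Γ ⊩ ⟨ M , N ⟩
  eL : ∀ {M K N} → (⟦ M ⟧ K) ∈ Γ → Γ ⊩ K → (M ∷ K ∷ Γ) ⊩ N → Γ ⊩ N
  eR : ∀ {M K} → Γ ⊩ M → Γ ⊩ K → Γ ⊩ (⟦ M ⟧ K)

data _⊩R_ (Γ : List Msg) : Msg → Set where
  id : ∀ {M} → M ∈ Γ → Γ ⊩R M
  pR : ∀ {M N} → Γ ⊩R M → Γ ⊩R N → Γ ⊩R ⟨ M , N ⟩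
  eR : ∀ {M K} → Γ ⊩R M → Γ ⊩R K → Γ ⊩R (⟦ M ⟧ K)

_⊩*_ : List Msg → List Msg → Set
Γ ⊩* Δ = All (Γ ⊩_) Δ

Subst : Set
Subst = ℕ → Msg

_·_ : Msg → Subst → Msg
name a · θ = name a
var x · θ = θ x
⟨ M , N ⟩ · θ = ⟨ M · θ , N · θ ⟩
(⟦ M ⟧ K) · θ = ⟦ M · θ ⟧ (K · θ)

_·L_ : List Msg → Subst → List Msg
Γ ·L θ = map (_· θ) Γ

GroundSubst : Subst → Set
GroundSubst θ = ∀ x → Ground (θ x)

data Kind : Set where
  proper right : Kind

record Constraint : Set where
  constructor _⊩[_]?_
  field
    lhs  : List Msg
    kind : Kind
    rhs  : Msg
open Constraint public

varsC : Constraint → List ℕ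
varsC c = varsL (lhs c) ++ vars (rhs c)

varsCs : List Constraint → List ℕ
varsCs = concatMap varsC

SatisfiedBy : Constraint → Subst → Set
SatisfiedBy (Σ' ⊩[ proper ]? M) θ = (Σ' ·L θ) ⊩ (M · θ)
SatisfiedBy (Σ' ⊩[ right ]? M) θ = (Σ' ·L θ) ⊩R (M · θ)

IsSolution : Subst → List Constraint → Set
IsSolution θ C = GroundSubst θ × All (λ c → SatisfiedBy c θ) C

Satisfiable : List Constraint → Set
Satisfiable C = ∃ λ θ → IsSolution θ C

dv : List Msg → List Msg → List Msg
dv Σj Σi = filter (λ N → all? (λ x → x ∈? varsL Σi) (vars N)) Σj

-- Deducibility constraint system (conditions (1) and (2)); indices are 0-based,
-- so the prefix C^j (constraints before j) is  take (toℕ j) C.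
IsDCS : List Constraint → Set
IsDCS C =
  (∀ (i j : Fin (length C)) → i <ᶠ j →
     ∀ θ → IsSolution θ (take (toℕ j) C) →
     (dv (lhs (lookup C j)) (lhs (lookup C i)) ·L θ) ⊩* (lhs (lookup C i) ·L θ))
  ×
  (∀ x → x ∈ varsCs C →
     Σ (Fin (length C)) λ i →
       (x ∈ vars (rhs (lookup C i))) ×
       (x ∉ varsL (lhs (lookup C i))) ×
       (∀ (j : Fin (length C)) → j <ᶠ i → x ∉ varsC (lookup C j)))

HasCommonName : List Constraint → Set
HasCommonName C = ∃ λ a → All (λ c → name a ∈ lhs c) C

module Submission where

-- A candidate is the name a or a non-variable subterm of C.  If a solution θ
-- maps a variable x to some t = θ x that is the θ-instance of no candidate,
-- replacing t everywhere by a yields a solution of smaller weight (the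
-- replacement lemma; by the two conditions on constraint systems, wherever t
-- occurs in a left side it was derivable from an earlier left side free of t).
-- So a satisfiable C has a minimal solution θ, with θ x = σ x · θ for a choice
-- σ of candidates, and θ is recovered from σ by iterated instantiation.  The
-- finitely many choices σ can be tested since ⊩ is decidable (saturate the
-- hypotheses under the left rules, then decide ⊩R).

open import Defs
open import Data.Nat using (ℕ; zero; suc; _<_; _≤_; _+_; z≤n; s≤s)
import Data.Nat.Properties as ℕ
open import Data.Fin using (Fin; toℕ) renaming (_<_ to _<ᶠ_)
import Data.Fin.Properties as Fin
open import Data.Fin.Induction using (<-wellFounded)
open import Induction.WellFounded using (Acc; acc)
open import Data.List using (List; []; _∷_; _++_; map; concatMap; length; lookup; filter)
open import Data.List.Properties using (filter-notAll)
open import Data.List.Relation.Unary.Any using (Any; here; there; any?)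
import Data.List.Relation.Unary.Any as Any
open import Data.List.Relation.Unary.Any.Properties using (lookup-index)
import Data.List.Relation.Unary.Any.Properties as Any
open import Data.List.Relation.Unary.All using (All; []; _∷_; all?)
import Data.List.Relation.Unary.All as All
import Data.List.Relation.Unary.All.Properties as All
open import Data.List.Membership.Propositional using (_∈_; _∉_; find; lose)
open import Data.List.Membership.Propositional.Properties
  using (∈-map⁺; ∈-++⁺ˡ; ∈-++⁺ʳ; ∈-++⁻; ∈-concatMap⁺; ∈-concatMap⁻; ∈-filter⁺; ∈-filter⁻; ∈-lookup)
import Data.List.Membership.DecPropositional as DecMembership
open import Data.List.Relation.Binary.Subset.Propositional using (_⊆_)
open import Data.List.Relation.Binary.Subset.Propositional.Properties using (∷⁺ʳ) renaming (map⁺ to ⊆-map⁺)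
open import Data.Product using (_×_; ∃; _,_; proj₁; proj₂; uncurry)
open import Data.Sum using (_⊎_; inj₁; inj₂)
open import Data.Empty using (⊥; ⊥-elim)
open import Data.Unit using (⊤; tt)
open import Function using (_∘_)
open import Relation.Nullary using (Dec; yes; no; ¬_; contradiction)
open import Relation.Nullary.Decidable using (map′; _×-dec_; ¬?; decidable-stable)
open import Relation.Unary using (Decidable)
open import Relation.Binary.PropositionalEquality
open import Relation.Binary.Definitions using (tri<; tri≈; tri>)

open DecMembership ℕ._≟_ using () renaming (_∈?_ to _∈ℕ?_)

infix 4 _≟M_
_≟M_ : (M N : Msg) → Dec (M ≡ N)
name b ≟M name c = map′ (cong name) (λ { refl → refl }) (b ℕ.≟ c)
var x ≟M var y = map′ (cong var) (λ { refl → refl }) (x ℕ.≟ y)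
⟨ M , N ⟩ ≟M ⟨ M′ , N′ ⟩ =
  map′ (uncurry (cong₂ ⟨_,_⟩)) (λ { refl → refl , refl }) (M ≟M M′ ×-dec N ≟M N′)
(⟦ M ⟧ K) ≟M (⟦ M′ ⟧ K′) =
  map′ (uncurry (cong₂ ⟦_⟧_)) (λ { refl → refl , refl }) (M ≟M M′ ×-dec K ≟M K′)
name _ ≟M var _ = no λ ()
name _ ≟M ⟨ _ , _ ⟩ = no λ ()
name _ ≟M (⟦ _ ⟧ _) = no λ ()
var _ ≟M name _ = no λ ()
var _ ≟M ⟨ _ , _ ⟩ = no λ ()
var _ ≟M (⟦ _ ⟧ _) = no λ ()
⟨ _ , _ ⟩ ≟M name _ = no λ ()
⟨ _ , _ ⟩ ≟M var _ = no λ ()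
⟨ _ , _ ⟩ ≟M (⟦ _ ⟧ _) = no λ ()
(⟦ _ ⟧ _) ≟M name _ = no λ ()
(⟦ _ ⟧ _) ≟M var _ = no λ ()
(⟦ _ ⟧ _) ≟M ⟨ _ , _ ⟩ = no λ ()

open DecMembership _≟M_ using () renaming (_∈?_ to _∈?M_)

module _ {A : Set} {P Q : A → Set} (P? : Decidable P) (Q? : Decidable Q) (P⇒Q : ∀ {x} → P x → Q x) where

  count-≤ : ∀ xs → length (filter P? xs) ≤ length (filter Q? xs)
  count-≤ [] = z≤n
  count-≤ (x ∷ xs) with P? x | Q? x
  ... | yes _ | yes _ = s≤s (count-≤ xs)
  ... | yes p | no ¬q = contradiction (P⇒Q p) ¬q
  ... | no _ | yes _ = ℕ.m≤n⇒m≤1+n (count-≤ xs)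
  ... | no _ | no _ = count-≤ xs

  count-< : ∀ {z} xs → z ∈ xs → ¬ P z → Q z → length (filter P? xs) < length (filter Q? xs)
  count-< (x ∷ xs) (here refl) ¬p q with P? x | Q? x
  ... | yes p | _ = contradiction p ¬p
  ... | no _ | yes _ = s≤s (count-≤ xs)
  ... | no _ | no ¬q = contradiction q ¬q
  count-< (x ∷ xs) (there z∈) ¬p q with P? x | Q? x
  ... | yes _ | yes _ = s≤s (count-< xs z∈ ¬p q)
  ... | yes p | no ¬q = contradiction (P⇒Q p) ¬q
  ... | no _ | yes _ = ℕ.m≤n⇒m≤1+n (count-< xs z∈ ¬p q)
  ... | no _ | no _ = count-< xs z∈ ¬p q

sumOver : {A : Set} → (A → ℕ) → List A → ℕ
sumOver f [] = 0
sumOver f (x ∷ xs) = f x + sumOver f xs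

sumOver-≤ : ∀ {A : Set} {f g : A → ℕ} xs → (∀ y → f y ≤ g y) → sumOver f xs ≤ sumOver g xs
sumOver-≤ [] f≤g = z≤n
sumOver-≤ (x ∷ xs) f≤g = ℕ.+-mono-≤ (f≤g x) (sumOver-≤ xs f≤g)

sumOver-< : ∀ {A : Set} {f g : A → ℕ} {x} xs → (∀ y → f y ≤ g y) → x ∈ xs → f x < g x →
            sumOver f xs < sumOver g xs
sumOver-< (x ∷ xs) f≤g (here refl) fx<gx = ℕ.+-mono-<-≤ fx<gx (sumOver-≤ xs f≤g)
sumOver-< (y ∷ xs) f≤g (there x∈) fx<gx = ℕ.+-mono-≤-< (f≤g y) (sumOver-< xs f≤g x∈ fx<gx)

All-fromIndices : ∀ {A : Set} {P : A → Set} (xs : List A) → (∀ i → P (lookup xs i)) → All P xs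
All-fromIndices {P = P} xs f = All.tabulate λ m → subst P (sym (lookup-index m)) (f (Any.index m))

wk : ∀ {Γ Δ M} → Γ ⊆ Δ → Γ ⊩ M → Δ ⊩ M
wk Γ⊆Δ (id m) = id (Γ⊆Δ m)
wk Γ⊆Δ (pL m d) = pL (Γ⊆Δ m) (wk (∷⁺ʳ _ (∷⁺ʳ _ Γ⊆Δ)) d)
wk Γ⊆Δ (pR d e) = pR (wk Γ⊆Δ d) (wk Γ⊆Δ e)
wk Γ⊆Δ (eL m k d) = eL (Γ⊆Δ m) (wk Γ⊆Δ k) (wk (∷⁺ʳ _ (∷⁺ʳ _ Γ⊆Δ)) d)
wk Γ⊆Δ (eR d e) = eR (wk Γ⊆Δ d) (wk Γ⊆Δ e)

wk₂ : ∀ {Γ P Q M} → Γ ⊩ M → (P ∷ Q ∷ Γ) ⊩ M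
wk₂ = wk (there ∘ there)

R⇒ : ∀ {Γ M} → Γ ⊩R M → Γ ⊩ M
R⇒ (id m) = id m
R⇒ (pR d e) = pR (R⇒ d) (R⇒ e)
R⇒ (eR d e) = eR (R⇒ d) (R⇒ e)

⊩*-refl : ∀ {Γ} → Γ ⊩* Γ
⊩*-refl = All.tabulate id

pair-inv : ∀ {Γ P Q} → Γ ⊩ ⟨ P , Q ⟩ → Γ ⊩ P × Γ ⊩ Q
pair-inv (id m) = pL m (id (here refl)) , pL m (id (there (here refl)))
pair-inv (pL m d) = let (dP , dQ) = pair-inv d in pL m dP , pL m dQ
pair-inv (pR dP dQ) = dP , dQ
pair-inv (eL m k d) = let (dP , dQ) = pair-inv d in eL m k dP , eL m k dQ

dec-inv : ∀ {Γ P K} → Γ ⊩ (⟦ P ⟧ K) → Γ ⊩ K → Γ ⊩ P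
dec-inv (id m) k = eL m k (id (here refl))
dec-inv (pL m d) k = pL m (dec-inv d (wk₂ k))
dec-inv (eL m k′ d) k = eL m k′ (dec-inv d (wk₂ k))
dec-inv (eR dP dK) k = dP

-- Cut: derivable messages may be used as hypotheses.  Each left rule on a
-- hypothesis of Δ is simulated by the corresponding inversion.
cut* : ∀ {Γ Δ M} → Γ ⊩* Δ → Δ ⊩ M → Γ ⊩ M
cut* ds (id m) = All.lookup ds m
cut* ds (pL m d) = let (dP , dQ) = pair-inv (All.lookup ds m) in cut* (dP ∷ dQ ∷ ds) d
cut* ds (pR d e) = pR (cut* ds d) (cut* ds e)
cut* ds (eL m k d) = let dK = cut* ds k in cut* (dec-inv (All.lookup ds m) dK ∷ dK ∷ ds) d
cut* ds (eR d e) = eR (cut* ds d) (cut* ds e)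

infix 4 _⊑_
data _⊑_ (u : Msg) : Msg → Set where
  ⊑refl : u ⊑ u
  ⊑pl : ∀ {M N} → u ⊑ M → u ⊑ ⟨ M , N ⟩
  ⊑pr : ∀ {M N} → u ⊑ N → u ⊑ ⟨ M , N ⟩
  ⊑el : ∀ {M K} → u ⊑ M → u ⊑ (⟦ M ⟧ K)
  ⊑er : ∀ {M K} → u ⊑ K → u ⊑ (⟦ M ⟧ K)

⊑-trans : ∀ {u v w} → u ⊑ v → v ⊑ w → u ⊑ w
⊑-trans p ⊑refl = p
⊑-trans p (⊑pl q) = ⊑pl (⊑-trans p q)
⊑-trans p (⊑pr q) = ⊑pr (⊑-trans p q)
⊑-trans p (⊑el q) = ⊑el (⊑-trans p q)
⊑-trans p (⊑er q) = ⊑er (⊑-trans p q)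

⊑-vars : ∀ {u v z} → u ⊑ v → z ∈ vars u → z ∈ vars v
⊑-vars ⊑refl z∈ = z∈
⊑-vars (⊑pl s) z∈ = ∈-++⁺ˡ (⊑-vars s z∈)
⊑-vars (⊑pr {M} s) z∈ = ∈-++⁺ʳ (vars M) (⊑-vars s z∈)
⊑-vars (⊑el s) z∈ = ∈-++⁺ˡ (⊑-vars s z∈)
⊑-vars (⊑er {M} s) z∈ = ∈-++⁺ʳ (vars M) (⊑-vars s z∈)

subterms : Msg → List Msg
subterms (name b) = name b ∷ []
subterms (var y) = var y ∷ []
subterms ⟨ M , N ⟩ = ⟨ M , N ⟩ ∷ subterms M ++ subterms N
subterms (⟦ M ⟧ K) = (⟦ M ⟧ K) ∷ subterms M ++ subterms K

subterms-sound : ∀ {u} N → u ∈ subterms N → u ⊑ N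
subterms-sound (name b) (here refl) = ⊑refl
subterms-sound (var y) (here refl) = ⊑refl
subterms-sound ⟨ M , N ⟩ (here refl) = ⊑refl
subterms-sound ⟨ M , N ⟩ (there u∈) with ∈-++⁻ (subterms M) u∈
... | inj₁ u∈M = ⊑pl (subterms-sound M u∈M)
... | inj₂ u∈N = ⊑pr (subterms-sound N u∈N)
subterms-sound (⟦ M ⟧ K) (here refl) = ⊑refl
subterms-sound (⟦ M ⟧ K) (there u∈) with ∈-++⁻ (subterms M) u∈
... | inj₁ u∈M = ⊑el (subterms-sound M u∈M)
... | inj₂ u∈K = ⊑er (subterms-sound K u∈K)

subterms-complete : ∀ {u N} → u ⊑ N → u ∈ subterms N
subterms-complete {N = name b} ⊑refl = here refl
subterms-complete {N = var y} ⊑refl = here refl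
subterms-complete {N = ⟨ M , N ⟩} ⊑refl = here refl
subterms-complete {N = ⟨ M , N ⟩} (⊑pl s) = there (∈-++⁺ˡ (subterms-complete s))
subterms-complete {N = ⟨ M , N ⟩} (⊑pr s) = there (∈-++⁺ʳ (subterms M) (subterms-complete s))
subterms-complete {N = ⟦ M ⟧ K} ⊑refl = here refl
subterms-complete {N = ⟦ M ⟧ K} (⊑el s) = there (∈-++⁺ˡ (subterms-complete s))
subterms-complete {N = ⟦ M ⟧ K} (⊑er s) = there (∈-++⁺ʳ (subterms M) (subterms-complete s))

_⊑?_ : ∀ u N → Dec (u ⊑ N)
u ⊑? N = map′ (subterms-sound N) subterms-complete (u ∈?M subterms N)

InSt : Msg → List Msg → Set
InSt u Γ = Any (u ⊑_) Γ

InSt? : ∀ u Γ → Dec (InSt u Γ)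
InSt? u = any? (u ⊑?_)

∈⇒InSt : ∀ {u Γ} → u ∈ Γ → InSt u Γ
∈⇒InSt m = lose m ⊑refl

InSt-⊑ : ∀ {u v Γ} → u ⊑ v → InSt v Γ → InSt u Γ
InSt-⊑ u⊑v = Any.map (⊑-trans u⊑v)

-- The messages a left rule adds to Γ are subterms of Γ, so they create no new
-- occurrences.
InSt-opened : ∀ {u v P Q Γ} → v ∈ Γ → P ⊑ v → Q ⊑ v → InSt u (P ∷ Q ∷ Γ) → InSt u Γ
InSt-opened v∈ P⊑v Q⊑v (here u⊑P) = lose v∈ (⊑-trans u⊑P P⊑v)
InSt-opened v∈ P⊑v Q⊑v (there (here u⊑Q)) = lose v∈ (⊑-trans u⊑Q Q⊑v)
InSt-opened v∈ P⊑v Q⊑v (there (there occ)) = occ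

pair-opened : ∀ {u P Q Γ} → ⟨ P , Q ⟩ ∈ Γ → InSt u (P ∷ Q ∷ Γ) → InSt u Γ
pair-opened m = InSt-opened m (⊑pl ⊑refl) (⊑pr ⊑refl)

enc-opened : ∀ {u P K Γ} → (⟦ P ⟧ K) ∈ Γ → InSt u (P ∷ K ∷ Γ) → InSt u Γ
enc-opened m = InSt-opened m (⊑el ⊑refl) (⊑er ⊑refl)

-- A subterm of a derivable message that does not occur in Γ is derivable:
-- it must have been built by the right rules.
sublem : ∀ {Γ M u} → Γ ⊩ M → u ⊑ M → ¬ InSt u Γ → Γ ⊩ u
sublem (id m) u⊑M fresh = ⊥-elim (fresh (lose m u⊑M))
sublem (pL m d) u⊑M fresh = pL m (sublem d u⊑M (fresh ∘ pair-opened m))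
sublem (eL m k d) u⊑M fresh = eL m k (sublem d u⊑M (fresh ∘ enc-opened m))
sublem (pR d e) ⊑refl fresh = pR d e
sublem (pR d e) (⊑pl u⊑M) fresh = sublem d u⊑M fresh
sublem (pR d e) (⊑pr u⊑N) fresh = sublem e u⊑N fresh
sublem (eR d e) ⊑refl fresh = eR d e
sublem (eR d e) (⊑el u⊑M) fresh = sublem d u⊑M fresh
sublem (eR d e) (⊑er u⊑K) fresh = sublem e u⊑K fresh

-- Likewise an encryption not occurring in Γ was composed, so its plaintext is
-- derivable (without knowing the key).
enc-comp : ∀ {Γ P K} → Γ ⊩ (⟦ P ⟧ K) → ¬ InSt (⟦ P ⟧ K) Γ → Γ ⊩ P
enc-comp (id m) fresh = ⊥-elim (fresh (∈⇒InSt m))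
enc-comp (pL m d) fresh = pL m (enc-comp d (fresh ∘ pair-opened m))
enc-comp (eL m k d) fresh = eL m k (enc-comp d (fresh ∘ enc-opened m))
enc-comp (eR d e) fresh = d

⊩R? : ∀ Γ M → Dec (Γ ⊩R M)
⊩R? Γ M with M ∈?M Γ
... | yes m = yes (id m)
⊩R? Γ (name b) | no ∉ = no λ { (id m) → ∉ m }
⊩R? Γ (var y) | no ∉ = no λ { (id m) → ∉ m }
⊩R? Γ ⟨ P , Q ⟩ | no ∉ =
  map′ (uncurry pR) (λ { (id m) → ⊥-elim (∉ m) ; (pR dP dQ) → dP , dQ }) (⊩R? Γ P ×-dec ⊩R? Γ Q)
⊩R? Γ (⟦ P ⟧ K) | no ∉ =
  map′ (uncurry eR) (λ { (id m) → ⊥-elim (∉ m) ; (eR dP dK) → dP , dK }) (⊩R? Γ P ×-dec ⊩R? Γ K)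

record Closed (Γ : List Msg) : Set where
  field
    pairs : ∀ {P Q} → ⟨ P , Q ⟩ ∈ Γ → P ∈ Γ × Q ∈ Γ
    encs : ∀ {P K} → (⟦ P ⟧ K) ∈ Γ → Γ ⊩R K → P ∈ Γ

-- Over a closed Γ the right derivations invert like the left rules, so the left
-- rules are superfluous: Γ ⊩ M implies Γ ⊩R M.
module _ {Γ : List Msg} (cl : Closed Γ) where

  pairR-inv : ∀ {P Q} → Γ ⊩R ⟨ P , Q ⟩ → Γ ⊩R P × Γ ⊩R Q
  pairR-inv (id m) = let (P∈ , Q∈) = Closed.pairs cl m in id P∈ , id Q∈
  pairR-inv (pR dP dQ) = dP , dQ

  decR-inv : ∀ {P K} → Γ ⊩R (⟦ P ⟧ K) → Γ ⊩R K → Γ ⊩R P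
  decR-inv (id m) dK = id (Closed.encs cl m dK)
  decR-inv (eR dP _) dK = dP

  closed⇒R : ∀ {Δ M} → All (Γ ⊩R_) Δ → Δ ⊩ M → Γ ⊩R M
  closed⇒R ds (id m) = All.lookup ds m
  closed⇒R ds (pL m d) = let (dP , dQ) = pairR-inv (All.lookup ds m) in closed⇒R (dP ∷ dQ ∷ ds) d
  closed⇒R ds (pR d e) = pR (closed⇒R ds d) (closed⇒R ds e)
  closed⇒R ds (eL m k d) = let dK = closed⇒R ds k in closed⇒R (decR-inv (All.lookup ds m) dK ∷ dK ∷ ds) d
  closed⇒R ds (eR d e) = eR (closed⇒R ds d) (closed⇒R ds e)

record Opening (Γ : List Msg) : Set where
  constructor opening
  field
    {source first second} : Msg
    source∈ : source ∈ Γ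
    first⊑ : first ⊑ source
    second⊑ : second ⊑ source
    new : ¬ (first ∈ Γ × second ∈ Γ)
    rule : ∀ {M} → (first ∷ second ∷ Γ) ⊩ M → Γ ⊩ M

Openable : List Msg → Msg → Set
Openable Γ ⟨ P , Q ⟩ = ¬ (P ∈ Γ × Q ∈ Γ)
Openable Γ (⟦ P ⟧ K) = Γ ⊩R K × P ∉ Γ
Openable Γ _ = ⊥

openable? : ∀ Γ u → Dec (Openable Γ u)
openable? Γ (name b) = no λ ()
openable? Γ (var y) = no λ ()
openable? Γ ⟨ P , Q ⟩ = ¬? (P ∈?M Γ ×-dec Q ∈?M Γ)
openable? Γ (⟦ P ⟧ K) = ⊩R? Γ K ×-dec ¬? (P ∈?M Γ)

toOpening : ∀ {Γ u} → u ∈ Γ → Openable Γ u → Opening Γ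
toOpening {u = ⟨ P , Q ⟩} m new = opening m (⊑pl ⊑refl) (⊑pr ⊑refl) new (pL m)
toOpening {u = ⟦ P ⟧ K} m (dK , P∉) = opening m (⊑el ⊑refl) (⊑er ⊑refl) (P∉ ∘ proj₁) (eL m (R⇒ dK))

opening-or-closed : ∀ Γ → Opening Γ ⊎ Closed Γ
opening-or-closed Γ with any? (openable? Γ) Γ
... | yes o = let (u , u∈ , op) = find o in inj₁ (toOpening u∈ op)
... | no ¬o = inj₂ record
  { pairs = λ {P} {Q} m → decidable-stable (P ∈?M Γ ×-dec Q ∈?M Γ) (¬o ∘ lose m)
  ; encs = λ {P} m dK → decidable-stable (P ∈?M Γ) (λ P∉ → ¬o (lose m (dK , P∉)))
  }

missing : List Msg → List Msg → ℕ
missing S Γ = length (filter (λ u → ¬? (u ∈?M Γ)) S)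

missing-< : ∀ S {Γ Γ′ u} → Γ ⊆ Γ′ → u ∈ S → u ∉ Γ → u ∈ Γ′ → missing S Γ′ < missing S Γ
missing-< S Γ⊆Γ′ u∈S u∉Γ u∈Γ′ =
  count-< (λ u → ¬? (u ∈?M _)) (λ u → ¬? (u ∈?M _)) (λ ∉Γ′ → ∉Γ′ ∘ Γ⊆Γ′) S u∈S (λ ∉Γ′ → ∉Γ′ u∈Γ′) u∉Γ

-- Deciding Γ₀ ⊩ M: open hypotheses until the set is closed, then decide ⊩R.
-- All hypotheses stay subterms of Γ₀, so the number of missing subterms of
-- Γ₀ strictly decreases along the saturation.
module Saturation (Γ₀ : List Msg) (M : Msg) where

  S : List Msg
  S = concatMap subterms Γ₀

  InSt⇒∈S : ∀ {u} → InSt u Γ₀ → u ∈ S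
  InSt⇒∈S occ = ∈-concatMap⁺ subterms (Any.map subterms-complete occ)

  progress : ∀ {Γ} → (∀ {u} → u ∈ Γ → InSt u Γ₀) → (o : Opening Γ) →
             missing S (Opening.first o ∷ Opening.second o ∷ Γ) < missing S Γ
  progress {Γ} inv (opening {first = P} {Q} v∈ P⊑v Q⊑v new _) with P ∈?M Γ
  ... | no P∉ = missing-< S (there ∘ there) (InSt⇒∈S (InSt-⊑ P⊑v (inv v∈))) P∉ (here refl)
  ... | yes P∈ = missing-< S (there ∘ there) (InSt⇒∈S (InSt-⊑ Q⊑v (inv v∈))) (λ Q∈ → new (P∈ , Q∈))
                           (there (here refl))

  decide : ∀ n Γ → missing S Γ < n → (∀ {u} → u ∈ Γ → InSt u Γ₀) → Dec (Γ ⊩ M)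
  decide (suc n) Γ bound inv with opening-or-closed Γ
  ... | inj₂ cl = map′ R⇒ (closed⇒R cl (All.tabulate id)) (⊩R? Γ M)
  ... | inj₁ o@(opening v∈ P⊑v Q⊑v new rule) =
    map′ rule wk₂ (decide n _ (ℕ.<-≤-trans (progress inv o) (ℕ.≤-pred bound)) inv′)
    where
    inv′ : ∀ {u} → u ∈ (Opening.first o ∷ Opening.second o ∷ Γ) → InSt u Γ₀
    inv′ (here refl) = InSt-⊑ P⊑v (inv v∈)
    inv′ (there (here refl)) = InSt-⊑ Q⊑v (inv v∈)
    inv′ (there (there u∈)) = inv u∈

⊩? : ∀ Γ M → Dec (Γ ⊩ M)
⊩? Γ M = Saturation.decide Γ M (suc (missing (Saturation.S Γ M) Γ)) Γ ℕ.≤-refl ∈⇒InSt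

satisfied? : ∀ c θ → Dec (SatisfiedBy c θ)
satisfied? (Σ′ ⊩[ proper ]? M) θ = ⊩? (Σ′ ·L θ) (M · θ)
satisfied? (Σ′ ⊩[ right ]? M) θ = ⊩R? (Σ′ ·L θ) (M · θ)

NonVar : Msg → Set
NonVar N = ∀ y → N ≢ var y

nonVar? : ∀ N → Dec (NonVar N)
nonVar? (name b) = yes λ _ ()
nonVar? (var y) = no λ nv → nv y refl
nonVar? ⟨ M , N ⟩ = yes λ _ ()
nonVar? (⟦ M ⟧ K) = yes λ _ ()

agree : ∀ N {f g : Subst} → (∀ z → z ∈ vars N → f z ≡ g z) → N · f ≡ N · g
agree (name b) f≗g = refl
agree (var y) f≗g = f≗g y (here refl)
agree ⟨ M , N ⟩ f≗g =
  cong₂ ⟨_,_⟩ (agree M (λ z → f≗g z ∘ ∈-++⁺ˡ)) (agree N (λ z → f≗g z ∘ ∈-++⁺ʳ (vars M)))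
agree (⟦ M ⟧ K) f≗g =
  cong₂ ⟦_⟧_ (agree M (λ z → f≗g z ∘ ∈-++⁺ˡ)) (agree K (λ z → f≗g z ∘ ∈-++⁺ʳ (vars M)))

agreeL : ∀ Γ {f g : Subst} → (∀ z → z ∈ varsL Γ → f z ≡ g z) → Γ ·L f ≡ Γ ·L g
agreeL [] f≗g = refl
agreeL (N ∷ Γ) f≗g = cong₂ _∷_ (agree N (λ z → f≗g z ∘ ∈-++⁺ˡ)) (agreeL Γ (λ z → f≗g z ∘ ∈-++⁺ʳ (vars N)))

var⊑ : ∀ N (θ : Subst) {y} → y ∈ vars N → θ y ⊑ N · θ
var⊑ (var y) θ (here refl) = ⊑refl
var⊑ ⟨ M , N ⟩ θ y∈ with ∈-++⁻ (vars M) y∈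
... | inj₁ y∈M = ⊑pl (var⊑ M θ y∈M)
... | inj₂ y∈N = ⊑pr (var⊑ N θ y∈N)
var⊑ (⟦ M ⟧ K) θ y∈ with ∈-++⁻ (vars M) y∈
... | inj₁ y∈M = ⊑el (var⊑ M θ y∈M)
... | inj₂ y∈K = ⊑er (var⊑ K θ y∈K)

inst⊑ : ∀ N (θ : Subst) {t} → t ⊑ N · θ →
        (∃ λ N′ → N′ ⊑ N × NonVar N′ × N′ · θ ≡ t) ⊎ (∃ λ y → y ∈ vars N × t ⊑ θ y)
inst⊑ (var y) θ t⊑ = inj₂ (y , here refl , t⊑)
inst⊑ (name b) θ ⊑refl = inj₁ (name b , ⊑refl , (λ _ ()) , refl)
inst⊑ ⟨ M , N ⟩ θ ⊑refl = inj₁ (⟨ M , N ⟩ , ⊑refl , (λ _ ()) , refl)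
inst⊑ (⟦ M ⟧ K) θ ⊑refl = inj₁ ((⟦ M ⟧ K) , ⊑refl , (λ _ ()) , refl)
inst⊑ ⟨ M , N ⟩ θ (⊑pl t⊑) with inst⊑ M θ t⊑
... | inj₁ (N′ , s , nv , e) = inj₁ (N′ , ⊑pl s , nv , e)
... | inj₂ (y , y∈ , s) = inj₂ (y , ∈-++⁺ˡ y∈ , s)
inst⊑ ⟨ M , N ⟩ θ (⊑pr t⊑) with inst⊑ N θ t⊑
... | inj₁ (N′ , s , nv , e) = inj₁ (N′ , ⊑pr s , nv , e)
... | inj₂ (y , y∈ , s) = inj₂ (y , ∈-++⁺ʳ (vars M) y∈ , s)
inst⊑ (⟦ M ⟧ K) θ (⊑el t⊑) with inst⊑ M θ t⊑
... | inj₁ (N′ , s , nv , e) = inj₁ (N′ , ⊑el s , nv , e)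
... | inj₂ (y , y∈ , s) = inj₂ (y , ∈-++⁺ˡ y∈ , s)
inst⊑ (⟦ M ⟧ K) θ (⊑er t⊑) with inst⊑ K θ t⊑
... | inj₁ (N′ , s , nv , e) = inj₁ (N′ , ⊑er s , nv , e)
... | inj₂ (y , y∈ , s) = inj₂ (y , ∈-++⁺ʳ (vars M) y∈ , s)

ground-inst : ∀ N (θ : Subst) → GroundSubst θ → Ground (N · θ)
ground-inst (name b) θ gθ z ()
ground-inst (var y) θ gθ = gθ y
ground-inst ⟨ M , N ⟩ θ gθ z z∈ with ∈-++⁻ (vars (M · θ)) z∈
... | inj₁ z∈M = ground-inst M θ gθ z z∈M
... | inj₂ z∈N = ground-inst N θ gθ z z∈N
ground-inst (⟦ M ⟧ K) θ gθ z z∈ with ∈-++⁻ (vars (M · θ)) z∈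
... | inj₁ z∈M = ground-inst M θ gθ z z∈M
... | inj₂ z∈K = ground-inst K θ gθ z z∈K

varsL⁺ : ∀ {Γ N z} → N ∈ Γ → z ∈ vars N → z ∈ varsL Γ
varsL⁺ N∈ z∈ = ∈-concatMap⁺ vars (lose N∈ z∈)

varsL⁻ : ∀ {Γ z} → z ∈ varsL Γ → ∃ λ N → N ∈ Γ × z ∈ vars N
varsL⁻ z∈ = find (∈-concatMap⁻ vars z∈)

InSt-var : ∀ θ Γ {u y} → y ∈ varsL Γ → u ⊑ θ y → InSt u (Γ ·L θ)
InSt-var θ Γ y∈ u⊑θy =
  let (N , N∈ , y∈N) = varsL⁻ y∈ in lose (∈-map⁺ (_· θ) N∈) (⊑-trans u⊑θy (var⊑ N θ y∈N))

-- Derivations from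
-- hypotheses containing a survive the replacement, provided the messages a
-- left rule extracts from t are still derivable after replacement (the
-- replacement lemma).
module Replace (t : Msg) (a : ℕ) where

  mutual
    rep : Msg → Msg
    rep s with s ≟M t
    ... | yes _ = name a
    ... | no _ = repInside s

    repInside : Msg → Msg
    repInside (name b) = name b
    repInside (var y) = var y
    repInside ⟨ M , N ⟩ = ⟨ rep M , rep N ⟩
    repInside (⟦ M ⟧ K) = ⟦ rep M ⟧ rep K

  repL : List Msg → List Msg
  repL = map rep

  rep-cases : ∀ {ℓ} (R : Msg → Set ℓ) s → R (name a) → (s ≢ t → R (repInside s)) → R (rep s)
  rep-cases R s hit miss with s ≟M t
  ... | yes _ = hit
  ... | no s≢t = miss s≢t

  rep-t : rep t ≡ name a
  rep-t = rep-cases (_≡ name a) t refl (λ t≢t → contradiction refl t≢t)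

  rep-≢ : ∀ {s} → s ≢ t → rep s ≡ repInside s
  rep-≢ {s} s≢t with s ≟M t
  ... | yes s≡t = contradiction s≡t s≢t
  ... | no _ = refl

  a∈repL : ∀ {Γ} → name a ∈ Γ → name a ∈ repL Γ
  a∈repL {Γ} m = subst (_∈ repL Γ) (rep-cases (_≡ name a) (name a) refl (λ _ → refl)) (∈-map⁺ rep m)

  rep-vars : ∀ s {z} → z ∈ vars (rep s) → z ∈ vars s
  rep-vars s = rep-cases (λ r → ∀ {z} → z ∈ vars r → z ∈ vars s) s (λ ()) (λ _ → inside s)
    where
    inside : ∀ s {z} → z ∈ vars (repInside s) → z ∈ vars s
    inside (name b) ()
    inside (var y) z∈ = z∈
    inside ⟨ M , N ⟩ z∈ with ∈-++⁻ (vars (rep M)) z∈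
    ... | inj₁ z∈M = ∈-++⁺ˡ (rep-vars M z∈M)
    ... | inj₂ z∈N = ∈-++⁺ʳ (vars M) (rep-vars N z∈N)
    inside (⟦ M ⟧ K) z∈ with ∈-++⁻ (vars (rep M)) z∈
    ... | inj₁ z∈M = ∈-++⁺ˡ (rep-vars M z∈M)
    ... | inj₂ z∈K = ∈-++⁺ʳ (vars M) (rep-vars K z∈K)

  rep-ground : ∀ θ → GroundSubst θ → GroundSubst (rep ∘ θ)
  rep-ground θ gθ y z = gθ y z ∘ rep-vars (θ y)

  Opens : List Msg → Msg → Set
  Opens Δ ⟨ P , Q ⟩ = Δ ⊩ rep P × Δ ⊩ rep Q
  Opens Δ (⟦ P ⟧ K) = Δ ⊩ rep P
  Opens Δ _ = ⊤

  Opens-wk : ∀ {Δ Δ′} s → Δ ⊆ Δ′ → Opens Δ s → Opens Δ′ s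
  Opens-wk (name b) Δ⊆Δ′ _ = tt
  Opens-wk (var y) Δ⊆Δ′ _ = tt
  Opens-wk ⟨ P , Q ⟩ Δ⊆Δ′ (dP , dQ) = wk Δ⊆Δ′ dP , wk Δ⊆Δ′ dQ
  Opens-wk (⟦ P ⟧ K) Δ⊆Δ′ dP = wk Δ⊆Δ′ dP

  opens-from : ∀ {Γ Δ} s → (∀ {u} → Γ ⊩ u → Δ ⊩ rep u) → Γ ⊩ s → ¬ InSt s Γ → Opens Δ s
  opens-from (name b) transfer ds fresh = tt
  opens-from (var y) transfer ds fresh = tt
  opens-from ⟨ P , Q ⟩ transfer ds fresh = transfer (proj₁ (pair-inv ds)) , transfer (proj₂ (pair-inv ds))
  opens-from (⟦ P ⟧ K) transfer ds fresh = transfer (enc-comp ds fresh)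

  opens-hyp : ∀ {Γ s} → (InSt t Γ → Opens (repL Γ) t) → s ∈ Γ → s ≡ t → Opens (repL Γ) s
  opens-hyp op m refl = op (∈⇒InSt m)

  -- The replacement lemma.  A composition equal to t becomes the hypothesis a;
  -- a decomposition of t is replaced by a cut with the derivable parts of t.
  rep-⊩ : ∀ {Γ M} → name a ∈ Γ → (InSt t Γ → Opens (repL Γ) t) → Γ ⊩ M → repL Γ ⊩ rep M
  rep-⊩ na op (id m) = id (∈-map⁺ rep m)
  rep-⊩ {Γ} na op (pR {M} {N} d e) =
    rep-cases (repL Γ ⊩_) ⟨ M , N ⟩ (id (a∈repL na)) (λ _ → pR (rep-⊩ na op d) (rep-⊩ na op e))
  rep-⊩ {Γ} na op (eR {M} {K} d e) =
    rep-cases (repL Γ ⊩_) (⟦ M ⟧ K) (id (a∈repL na)) (λ _ → eR (rep-⊩ na op d) (rep-⊩ na op e))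
  rep-⊩ {Γ} {M} na op (pL {P} {Q} m d) = decompose (⟨ P , Q ⟩ ≟M t)
    where
    ih : (rep P ∷ rep Q ∷ repL Γ) ⊩ rep M
    ih = rep-⊩ (there (there na)) (Opens-wk t (there ∘ there) ∘ op ∘ pair-opened m) d
    decompose : Dec (⟨ P , Q ⟩ ≡ t) → repL Γ ⊩ rep M
    decompose (yes pair≡t) = let (dP , dQ) = opens-hyp op m pair≡t in cut* (dP ∷ dQ ∷ ⊩*-refl) ih
    decompose (no pair≢t) = pL (subst (_∈ repL Γ) (rep-≢ pair≢t) (∈-map⁺ rep m)) ih
  rep-⊩ {Γ} {M} na op (eL {P} {K} m k d) = decompose ((⟦ P ⟧ K) ≟M t)
    where
    ihK : repL Γ ⊩ rep K
    ihK = rep-⊩ na op k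
    ih : (rep P ∷ rep K ∷ repL Γ) ⊩ rep M
    ih = rep-⊩ (there (there na)) (Opens-wk t (there ∘ there) ∘ op ∘ enc-opened m) d
    decompose : Dec ((⟦ P ⟧ K) ≡ t) → repL Γ ⊩ rep M
    decompose (yes enc≡t) = cut* (opens-hyp op m enc≡t ∷ ihK ∷ ⊩*-refl) ih
    decompose (no enc≢t) = eL (subst (_∈ repL Γ) (rep-≢ enc≢t) (∈-map⁺ rep m)) ihK ih

  rep-⊩R : ∀ {Γ M} → name a ∈ Γ → Γ ⊩R M → repL Γ ⊩R rep M
  rep-⊩R na (id m) = id (∈-map⁺ rep m)
  rep-⊩R {Γ} na (pR {M} {N} d e) =
    rep-cases (repL Γ ⊩R_) ⟨ M , N ⟩ (id (a∈repL na)) (λ _ → pR (rep-⊩R na d) (rep-⊩R na e))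
  rep-⊩R {Γ} na (eR {M} {K} d e) =
    rep-cases (repL Γ ⊩R_) (⟦ M ⟧ K) (id (a∈repL na)) (λ _ → eR (rep-⊩R na d) (rep-⊩R na e))

  rep-⊩-fresh : ∀ {Γ M} → name a ∈ Γ → ¬ InSt t Γ → Γ ⊩ M → repL Γ ⊩ rep M
  rep-⊩-fresh na fresh = rep-⊩ na (⊥-elim ∘ fresh)

  Avoids : Subst → Msg → Set
  Avoids θ N = ∀ {N′} → N′ ⊑ N → NonVar N′ → N′ · θ ≢ t

  rep-· : ∀ θ N → Avoids θ N → rep (N · θ) ≡ N · (rep ∘ θ)
  rep-· θ (var y) av = refl
  rep-· θ (name b) av = rep-≢ (av ⊑refl λ _ ())
  rep-· θ ⟨ M , N ⟩ av =
    trans (rep-≢ (av ⊑refl λ _ ())) (cong₂ ⟨_,_⟩ (rep-· θ M (av ∘ ⊑pl)) (rep-· θ N (av ∘ ⊑pr)))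
  rep-· θ (⟦ M ⟧ K) av =
    trans (rep-≢ (av ⊑refl λ _ ())) (cong₂ ⟦_⟧_ (rep-· θ M (av ∘ ⊑el)) (rep-· θ K (av ∘ ⊑er)))

  rep-·L : ∀ θ Γ → (∀ {N} → N ∈ Γ → Avoids θ N) → repL (Γ ·L θ) ≡ Γ ·L (rep ∘ θ)
  rep-·L θ [] av = refl
  rep-·L θ (N ∷ Γ) av = cong₂ _∷_ (rep-· θ N (av (here refl))) (rep-·L θ Γ (av ∘ there))

  through-var : ∀ θ N → Avoids θ N → t ⊑ N · θ → ∃ λ y → y ∈ vars N × t ⊑ θ y
  through-var θ N av t⊑ with inst⊑ N θ t⊑
  ... | inj₁ (N′ , s , nv , e) = ⊥-elim (av s nv e)
  ... | inj₂ r = r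

  InSt-instance : ∀ θ Γ → (∀ {N} → N ∈ Γ → Avoids θ N) → InSt t (Γ ·L θ) → ∃ λ y → y ∈ varsL Γ × t ⊑ θ y
  InSt-instance θ Γ av occ =
    let (N , N∈ , t⊑) = find (Any.map⁻ occ)
        (y , y∈ , t⊑θy) = through-var θ N (av N∈) t⊑
    in y , varsL⁺ N∈ y∈ , t⊑θy

  rep-satisfied : ∀ c θ → (∀ {N} → N ∈ lhs c → Avoids θ N) → Avoids θ (rhs c) → name a ∈ (lhs c ·L θ) →
                  (InSt t (lhs c ·L θ) → Opens (repL (lhs c ·L θ)) t) → SatisfiedBy c θ → SatisfiedBy c (rep ∘ θ)
  rep-satisfied (Σ′ ⊩[ proper ]? M) θ avL avR na op d = subst₂ _⊩_ (rep-·L θ Σ′ avL) (rep-· θ M avR) (rep-⊩ na op d)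
  rep-satisfied (Σ′ ⊩[ right ]? M) θ avL avR na op d = subst₂ _⊩R_ (rep-·L θ Σ′ avL) (rep-· θ M avR) (rep-⊩R na d)

satisfied⇒⊩ : ∀ c θ → SatisfiedBy c θ → (lhs c ·L θ) ⊩ (rhs c · θ)
satisfied⇒⊩ (Σ′ ⊩[ proper ]? M) θ d = d
satisfied⇒⊩ (Σ′ ⊩[ right ]? M) θ d = R⇒ d

constraintMsgs : Constraint → List Msg
constraintMsgs c = rhs c ∷ lhs c

messages : List Constraint → List Msg
messages = concatMap constraintMsgs

at-index : ∀ {P : Constraint → Set} C i → P (lookup C i) → Any P C
at-index C i = lose (∈-lookup {xs = C} i)

lhs∈messages : ∀ C i {N} → N ∈ lhs (lookup C i) → N ∈ messages C
lhs∈messages C i {N} N∈ = ∈-concatMap⁺ constraintMsgs (at-index {P = (N ∈_) ∘ constraintMsgs} C i (there N∈))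

rhs∈messages : ∀ C i → rhs (lookup C i) ∈ messages C
rhs∈messages C i = ∈-concatMap⁺ constraintMsgs (at-index {P = (rhs (lookup C i) ∈_) ∘ constraintMsgs} C i (here refl))

messages-vars : ∀ C {N z} → N ∈ messages C → z ∈ vars N → z ∈ varsCs C
messages-vars C {z = z} N∈ z∈ =
  let (c , c∈ , N∈c) = find (∈-concatMap⁻ constraintMsgs {xs = C} N∈)
  in ∈-concatMap⁺ varsC (lose c∈ (in-c c N∈c z∈))
  where
  in-c : ∀ c {N} → N ∈ constraintMsgs c → z ∈ vars N → z ∈ varsC c
  in-c c (here refl) z∈ = ∈-++⁺ʳ (varsL (lhs c)) z∈
  in-c c (there N∈) z∈ = ∈-++⁺ˡ (varsL⁺ N∈ z∈)

candidates : ℕ → List Constraint → List Msg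
candidates a C = name a ∷ filter nonVar? (concatMap subterms (messages C))

candidate : ∀ a C {N N′} → N ∈ messages C → N′ ⊑ N → NonVar N′ → N′ ∈ candidates a C
candidate a C N∈ s nv = there (∈-filter⁺ nonVar? (∈-concatMap⁺ subterms (lose N∈ (subterms-complete s))) nv)

candidate-nonVar : ∀ a C {N} → N ∈ candidates a C → NonVar N
candidate-nonVar a C (here refl) = λ _ ()
candidate-nonVar a C (there N∈) = proj₂ (∈-filter⁻ nonVar? {xs = concatMap subterms (messages C)} N∈)

candidate-vars : ∀ a C {N z} → N ∈ candidates a C → z ∈ vars N → z ∈ varsCs C
candidate-vars a C (here refl) ()
candidate-vars a C (there N∈) z∈ =
  let (M , M∈ , N∈M) = find (∈-concatMap⁻ subterms (proj₁ (∈-filter⁻ nonVar? {xs = concatMap subterms (messages C)} N∈)))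
  in messages-vars C M∈ (⊑-vars (subterms-sound M N∈M) z∈)

module _ (Σj Σi : List Msg) where

  private
    keep? : ∀ N → Dec (All (_∈ varsL Σi) (vars N))
    keep? N = all? (λ x → x ∈ℕ? varsL Σi) (vars N)

  dv-⊆ : dv Σj Σi ⊆ Σj
  dv-⊆ = proj₁ ∘ ∈-filter⁻ keep? {xs = Σj}

  dv-vars : ∀ {N z} → N ∈ dv Σj Σi → z ∈ vars N → z ∈ varsL Σi
  dv-vars N∈ = All.lookup (proj₂ (∈-filter⁻ keep? {xs = Σj} N∈))

  dv-name : ∀ {b} → name b ∈ Σj → name b ∈ dv Σj Σi
  dv-name m = ∈-filter⁺ keep? m []

origin : ∀ C → IsDCS C → ∀ j {y} → y ∈ varsL (lhs (lookup C j)) → ∃ λ k → k <ᶠ j × y ∈ vars (rhs (lookup C k))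
origin C (_ , orig) j {y} y∈ with orig y (∈-concatMap⁺ varsC (at-index {P = (y ∈_) ∘ varsC} C j (∈-++⁺ˡ y∈)))
... | k , y∈Mk , y∉Σk , not-before-k with Fin.<-cmp k j
... | tri< k<j _ _ = k , k<j , y∈Mk
... | tri≈ _ k≡j _ = ⊥-elim (y∉Σk (subst (λ i → y ∈ varsL (lhs (lookup C i))) (sym k≡j) y∈))
... | tri> _ _ j<k = ⊥-elim (not-before-k j j<k (∈-++⁺ˡ y∈))

module ReplacementStep
  (C : List Constraint) (dcs : IsDCS C) (a : ℕ) (na : All (λ c → name a ∈ lhs c) C)
  (θ : Subst) (sol : IsSolution θ C) (t : Msg) (fresh : ∀ {N} → N ∈ candidates a C → N · θ ≢ t)
  where
  open Replace t a

  Σθ : Fin (length C) → List Msg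
  Σθ i = lhs (lookup C i) ·L θ

  avoids-lhs : ∀ j {N} → N ∈ lhs (lookup C j) → Avoids θ N
  avoids-lhs j N∈ s nv = fresh (candidate a C (lhs∈messages C j N∈) s nv)

  avoids-rhs : ∀ j → Avoids θ (rhs (lookup C j))
  avoids-rhs j s nv = fresh (candidate a C (rhs∈messages C j) s nv)

  a∈Σθ : ∀ j → name a ∈ Σθ j
  a∈Σθ j = ∈-map⁺ (_· θ) (All.lookup na (∈-lookup j))

  solves : ∀ i → SatisfiedBy (lookup C i) θ
  solves i = All.lookup (proj₂ sol) (∈-lookup i)

  -- If t occurs in Σⱼθ it lies inside the image of a variable of Σⱼ, hence in
  -- the right side of an earlier constraint; descending to the earliest such
  -- constraint, t does not occur in its left side.
  first-occurrence : ∀ j → InSt t (Σθ j) →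
                     ∃ λ i → i <ᶠ j × t ⊑ rhs (lookup C i) · θ × ¬ InSt t (Σθ i)
  first-occurrence j = go j (<-wellFounded j)
    where
    go : ∀ j → Acc _<ᶠ_ j → InSt t (Σθ j) → ∃ λ i → i <ᶠ j × t ⊑ rhs (lookup C i) · θ × ¬ InSt t (Σθ i)
    go j (acc earlier) occ with InSt-instance θ (lhs (lookup C j)) (avoids-lhs j) occ
    ... | y , y∈ , t⊑θy with origin C dcs j y∈
    ... | k , k<j , y∈Mk with InSt? t (Σθ k)
    ... | no fresh-k = k , k<j , ⊑-trans t⊑θy (var⊑ (rhs (lookup C k)) θ y∈Mk) , fresh-k
    ... | yes occ-k = let (i , i<k , rest) = go k (earlier k<j) occ-k in i , Fin.<-trans i<k k<j , rest

  -- Condition (1) transfers derivations from an earlier left side Σᵢθ free of t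
  -- to the replaced Σⱼθ: the part of Σⱼθ kept by dv derives Σᵢθ and is free of t.
  transfer : ∀ {i j} → i <ᶠ j → ¬ InSt t (Σθ i) → ∀ {u} → Σθ i ⊩ u → repL (Σθ j) ⊩ rep u
  transfer {i} {j} i<j fresh-i du =
    wk (⊆-map⁺ rep (⊆-map⁺ (_· θ) (dv-⊆ Σj Σi)))
       (cut* (All.map⁺ (All.map (rep-⊩-fresh a∈kept fresh-kept) kept⊩Σi)) (rep-⊩-fresh (a∈Σθ i) fresh-i du))
    where
    Σi Σj : List Msg
    Σi = lhs (lookup C i)
    Σj = lhs (lookup C j)
    kept : List Msg
    kept = dv Σj Σi ·L θ
    kept⊩Σi : kept ⊩* Σθ i
    kept⊩Σi = proj₁ dcs i j i<j θ (proj₁ sol , All.take⁺ (toℕ j) (proj₂ sol))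
    a∈kept : name a ∈ kept
    a∈kept = ∈-map⁺ (_· θ) (dv-name Σj Σi (All.lookup na (∈-lookup j)))
    fresh-kept : ¬ InSt t kept
    fresh-kept occ =
      let (y , y∈ , t⊑θy) = InSt-instance θ (dv Σj Σi) (avoids-lhs j ∘ dv-⊆ Σj Σi) occ
          (N , N∈ , y∈N) = varsL⁻ y∈
      in fresh-i (InSt-var θ Σi (dv-vars Σj Σi N∈ y∈N) t⊑θy)

  -- Whenever t occurs in Σⱼθ, its parts are derivable from the replaced Σⱼθ:
  -- t itself is derivable from the earliest Σᵢθ (by sublem) and transfers.
  opens-at : ∀ j → InSt t (Σθ j) → Opens (repL (Σθ j)) t
  opens-at j occ =
    let (i , i<j , t⊑Mi , fresh-i) = first-occurrence j occ
    in opens-from t (transfer i<j fresh-i) (sublem (satisfied⇒⊩ (lookup C i) θ (solves i)) t⊑Mi fresh-i) fresh-i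

  solution : IsSolution (rep ∘ θ) C
  solution = rep-ground θ (proj₁ sol) , All-fromIndices C λ j →
    rep-satisfied (lookup C j) θ (avoids-lhs j) (avoids-rhs j) (a∈Σθ j) (opens-at j) (solves j)

-- The weight of a message relative to a: the name a and variables weigh 1,
-- other names 2.  Replacing a message by a never increases the weight, and
-- strictly decreases the weight of the replaced message unless it is a or a variable.
module Weight (a : ℕ) where

  weight : Msg → ℕ
  weight (name b) with b ℕ.≟ a
  ... | yes _ = 1
  ... | no _ = 2
  weight (var y) = 1
  weight ⟨ M , N ⟩ = suc (weight M + weight N)
  weight (⟦ M ⟧ K) = suc (weight M + weight K)

  weight-a : weight (name a) ≡ 1
  weight-a with a ℕ.≟ a
  ... | yes _ = refl
  ... | no a≢a = contradiction refl a≢a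

  weight-pos : ∀ s → 1 ≤ weight s
  weight-pos (name b) with b ℕ.≟ a
  ... | yes _ = s≤s z≤n
  ... | no _ = s≤s z≤n
  weight-pos (var y) = s≤s z≤n
  weight-pos ⟨ M , N ⟩ = s≤s z≤n
  weight-pos (⟦ M ⟧ K) = s≤s z≤n

  weight>1 : ∀ s → s ≢ name a → NonVar s → 1 < weight s
  weight>1 (name b) s≢a nv with b ℕ.≟ a
  ... | yes refl = contradiction refl s≢a
  ... | no _ = s≤s (s≤s z≤n)
  weight>1 (var y) s≢a nv = contradiction refl (nv y)
  weight>1 ⟨ M , N ⟩ s≢a nv = s≤s (ℕ.≤-trans (weight-pos M) (ℕ.m≤m+n (weight M) (weight N)))
  weight>1 (⟦ M ⟧ K) s≢a nv = s≤s (ℕ.≤-trans (weight-pos M) (ℕ.m≤m+n (weight M) (weight K)))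

  module _ (t : Msg) where
    open Replace t a

    weight-rep : ∀ s → weight (rep s) ≤ weight s
    weight-rep s = rep-cases (λ r → weight r ≤ weight s) s
                     (subst (_≤ weight s) (sym weight-a) (weight-pos s)) (λ _ → inside s)
      where
      inside : ∀ s → weight (repInside s) ≤ weight s
      inside (name b) = ℕ.≤-refl
      inside (var y) = ℕ.≤-refl
      inside ⟨ M , N ⟩ = s≤s (ℕ.+-mono-≤ (weight-rep M) (weight-rep N))
      inside (⟦ M ⟧ K) = s≤s (ℕ.+-mono-≤ (weight-rep M) (weight-rep K))

    weight-rep-t : t ≢ name a → NonVar t → weight (rep t) < weight t
    weight-rep-t t≢a nv = subst (_< weight t) (sym (trans (cong weight rep-t) weight-a)) (weight>1 t t≢a nv)

Minimal : ℕ → List Constraint → Subst → Set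
Minimal a C θ = ∀ x → x ∈ varsCs C → ∃ λ N → N ∈ candidates a C × θ x ≡ N · θ

-- Every satisfiable system has a minimal solution: while some variable x is
-- not mapped to a candidate instance, replace t = θ x by a; this keeps a
-- solution and decreases the total weight of the variables of C.
minimal-solution : ∀ C → IsDCS C → ∀ a → All (λ c → name a ∈ lhs c) C →
                   ∀ θ → IsSolution θ C → ∃ λ θ′ → IsSolution θ′ C × Minimal a C θ′
minimal-solution C dcs a na θ sol = go _ θ ℕ.≤-refl sol
  where
  open Weight a
  xs : List ℕ
  xs = varsCs C

  instance? : ∀ θ x → Dec (Any (λ N → θ x ≡ N · θ) (candidates a C))
  instance? θ x = any? (λ N → θ x ≟M N · θ) (candidates a C)

  go : ∀ n θ → sumOver (weight ∘ θ) xs < n → IsSolution θ C → ∃ λ θ′ → IsSolution θ′ C × Minimal a C θ′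
  go (suc n) θ bound sol with all? (instance? θ) xs
  ... | yes inst = θ , sol , λ x x∈ → find (All.lookup inst x∈)
  ... | no ¬inst =
    let (x , x∈ , not-inst) = find (All.¬All⇒Any¬ (instance? θ) xs ¬inst)
        fresh : ∀ {N} → N ∈ candidates a C → N · θ ≢ θ x
        fresh N∈ Nθ≡θx = not-inst (lose N∈ (sym Nθ≡θx))
        θx-nonVar : NonVar (θ x)
        θx-nonVar y θx≡y = proj₁ sol x y (subst (λ u → y ∈ vars u) (sym θx≡y) (here refl))
        lighter = sumOver-< xs (λ y → weight-rep (θ x) (θ y)) x∈
                    (weight-rep-t (θ x) (fresh (here refl) ∘ sym) θx-nonVar)
    in go n _ (ℕ.<-≤-trans lighter (ℕ.≤-pred bound)) (ReplacementStep.solution C dcs a na θ sol (θ x) fresh)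

size : Msg → ℕ
size (name b) = 1
size (var y) = 1
size ⟨ M , N ⟩ = suc (size M + size N)
size (⟦ M ⟧ K) = suc (size M + size K)

size-⊑ : ∀ {u v} → u ⊑ v → size u ≤ size v
size-⊑ ⊑refl = ℕ.≤-refl
size-⊑ (⊑pl {M} {N} s) = ℕ.m≤n⇒m≤1+n (ℕ.≤-trans (size-⊑ s) (ℕ.m≤m+n (size M) (size N)))
size-⊑ (⊑pr {M} {N} s) = ℕ.m≤n⇒m≤1+n (ℕ.≤-trans (size-⊑ s) (ℕ.m≤n+m (size N) (size M)))
size-⊑ (⊑el {M} {K} s) = ℕ.m≤n⇒m≤1+n (ℕ.≤-trans (size-⊑ s) (ℕ.m≤m+n (size M) (size K)))
size-⊑ (⊑er {M} {K} s) = ℕ.m≤n⇒m≤1+n (ℕ.≤-trans (size-⊑ s) (ℕ.m≤n+m (size K) (size M)))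

size-var : ∀ N (θ : Subst) {z} → NonVar N → z ∈ vars N → size (θ z) < size (N · θ)
size-var (var y) θ nv _ = contradiction refl (nv y)
size-var ⟨ M , N ⟩ θ nv z∈ with ∈-++⁻ (vars M) z∈
... | inj₁ z∈M = s≤s (ℕ.≤-trans (size-⊑ (var⊑ M θ z∈M)) (ℕ.m≤m+n _ _))
... | inj₂ z∈N = s≤s (ℕ.≤-trans (size-⊑ (var⊑ N θ z∈N)) (ℕ.m≤n+m _ _))
size-var (⟦ M ⟧ K) θ nv z∈ with ∈-++⁻ (vars M) z∈
... | inj₁ z∈M = s≤s (ℕ.≤-trans (size-⊑ (var⊑ M θ z∈M)) (ℕ.m≤m+n _ _))
... | inj₂ z∈K = s≤s (ℕ.≤-trans (size-⊑ (var⊑ K θ z∈K)) (ℕ.m≤n+m _ _))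

unfold : ℕ → Subst → ℕ → Subst
unfold a σ zero y = name a
unfold a σ (suc k) y = σ y · unfold a σ k

unfold-ground : ∀ a σ k → GroundSubst (unfold a σ k)
unfold-ground a σ zero y z ()
unfold-ground a σ (suc k) y = ground-inst (σ y) (unfold a σ k) (unfold-ground a σ k)

-- The variables of σ y have θ-images smaller than θ y, so the number of
-- variables of C with θ-image smaller than θ y bounds the depth needed at y.
module Reconstruct (C : List Constraint) (a : ℕ) (θ σ : Subst)
  (choice : ∀ y → y ∈ varsCs C → σ y ∈ candidates a C × θ y ≡ σ y · θ) where
  open ≡-Reasoning

  xs : List ℕ
  xs = varsCs C

  rank : ℕ → ℕ
  rank y = length (filter (λ z → size (θ z) ℕ.<? size (θ y)) xs)

  rank-< : ∀ {y z} → y ∈ xs → z ∈ vars (σ y) → z ∈ xs × rank z < rank y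
  rank-< {y} {z} y∈ z∈ = z∈xs , count-< _ _ (λ θz′<θz → ℕ.<-trans θz′<θz θz<θy) xs z∈xs (ℕ.<-irrefl refl) θz<θy
    where
    σy∈ = proj₁ (choice y y∈)
    z∈xs : z ∈ xs
    z∈xs = candidate-vars a C σy∈ z∈
    θz<θy : size (θ z) < size (θ y)
    θz<θy = subst (λ u → size (θ z) < size u) (sym (proj₂ (choice y y∈))) (size-var (σ y) θ (candidate-nonVar a C σy∈) z∈)

  unfold-agrees : ∀ k y → y ∈ xs → rank y < k → unfold a σ k y ≡ θ y
  unfold-agrees (suc k) y y∈ bound = begin
    σ y · unfold a σ k  ≡⟨ agree (σ y) (λ z z∈ → let (z∈xs , rz<ry) = rank-< y∈ z∈ in
                                        unfold-agrees k z z∈xs (ℕ.<-≤-trans rz<ry (ℕ.≤-pred bound))) ⟩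
    σ y · θ             ≡⟨ sym (proj₂ (choice y y∈)) ⟩
    θ y                 ∎

  reconstruct : ∀ y → y ∈ xs → unfold a σ (length xs) y ≡ θ y
  reconstruct y y∈ =
    unfold-agrees (length xs) y y∈ (filter-notAll (λ z → size (θ z) ℕ.<? size (θ y)) xs (lose y∈ (ℕ.<-irrefl refl)))

satisfied-agree : ∀ c {f g : Subst} → (∀ z → z ∈ varsC c → f z ≡ g z) → SatisfiedBy c f → SatisfiedBy c g
satisfied-agree (Σ′ ⊩[ proper ]? M) f≗g =
  subst₂ _⊩_ (agreeL Σ′ (λ z → f≗g z ∘ ∈-++⁺ˡ)) (agree M (λ z → f≗g z ∘ ∈-++⁺ʳ (varsL Σ′)))
satisfied-agree (Σ′ ⊩[ right ]? M) f≗g =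
  subst₂ _⊩R_ (agreeL Σ′ (λ z → f≗g z ∘ ∈-++⁺ˡ)) (agree M (λ z → f≗g z ∘ ∈-++⁺ʳ (varsL Σ′)))

solution-agree : ∀ C {f g : Subst} → (∀ z → z ∈ varsCs C → f z ≡ g z) →
                 All (λ c → SatisfiedBy c f) C → All (λ c → SatisfiedBy c g) C
solution-agree [] f≗g [] = []
solution-agree (c ∷ C) f≗g (s ∷ ss) =
  satisfied-agree c (λ z → f≗g z ∘ ∈-++⁺ˡ) s ∷ solution-agree C (λ z → f≗g z ∘ ∈-++⁺ʳ (varsC c)) ss

update : Subst → ℕ → Msg → Subst
update f x N y with y ℕ.≟ x
... | yes _ = N
... | no _ = f y

assignments : ℕ → List Msg → List ℕ → List Subst
assignments a cs [] = (λ _ → name a) ∷ []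
assignments a cs (x ∷ xs) = concatMap (λ f → map (update f x) cs) (assignments a cs xs)

assignments-complete : ∀ a cs xs {P : ℕ → Msg → Set} → (∀ y → y ∈ xs → ∃ λ N → N ∈ cs × P y N) →
                       ∃ λ f → f ∈ assignments a cs xs × (∀ y → y ∈ xs → f y ∈ cs × P y (f y))
assignments-complete a cs [] choose = _ , here refl , λ y ()
assignments-complete a cs (x ∷ xs) {P} choose =
  update f₀ x N , ∈-concatMap⁺ (λ f → map (update f x) cs) (lose f₀∈ (∈-map⁺ (update f₀ x) N∈)) , chosen
  where
  N = proj₁ (choose x (here refl))
  N∈ = proj₁ (proj₂ (choose x (here refl)))
  rest = assignments-complete a cs xs (λ y → choose y ∘ there)
  f₀ = proj₁ rest
  f₀∈ = proj₁ (proj₂ rest)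
  chosen : ∀ y → y ∈ x ∷ xs → update f₀ x N y ∈ cs × P y (update f₀ x N y)
  chosen y y∈ with y ℕ.≟ x
  ... | yes refl = proj₂ (choose x (here refl))
  chosen y (here y≡x) | no y≢x = contradiction y≡x y≢x
  chosen y (there y∈) | no _ = proj₂ (proj₂ rest) y y∈

candidateSolution : ℕ → List Constraint → Subst → Subst
candidateSolution a C σ = unfold a σ (length (varsCs C))

-- θ satisfies every constraint of C (groundness aside).
Solves : List Constraint → Subst → Set
Solves C θ = All (λ c → SatisfiedBy c θ) C

-- A satisfiable system is solved by one of the candidate solutions: the one
-- determined by the candidate choice of a minimal solution.
complete : ∀ C a → IsDCS C → All (λ c → name a ∈ lhs c) C → Satisfiable C →
           Any (Solves C ∘ candidateSolution a C) (assignments a (candidates a C) (varsCs C))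
complete C a dcs na (θ , sol) =
  let (θm , solm , min) = minimal-solution C dcs a na θ sol
      (σ , σ∈ , choice) = assignments-complete a (candidates a C) (varsCs C) min
  in lose σ∈ (solution-agree C (λ z z∈ → sym (Reconstruct.reconstruct C a θm σ choice z z∈)) (proj₂ solm))

theorem6p13 : (C : List Constraint) → IsDCS C → HasCommonName C → Dec (Satisfiable C)
theorem6p13 C dcs (a , na) =
  map′ sound (complete C a dcs na)
       (any? (λ σ → all? (λ c → satisfied? c (candidateSolution a C σ)) C) (assignments a (candidates a C) (varsCs C)))
  where
  sound : Any (Solves C ∘ candidateSolution a C) (assignments a (candidates a C) (varsCs C)) → Satisfiable C
  sound found = let (σ , solves) = Any.satisfied found in candidateSolution a C σ , unfold-ground a σ (length (varsCs C)) , solves
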